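{- Let $G=(V,E)$ be a graph on $n$ vertices. If $p(G;i)=\binom{n}{i}$ for some $i\in\{1,\ldots,n\}$, then $p(G;j)=\binom{n}{j}$ for every $j\in\{i,\ldots,n\}$.
   Context: Graphs are finite and simple with nonempty vertex set. For $S\subseteq V$, color the vertices of $S$; then (domination step) every neighbor of a vertex of $S$ becomes colored; then repeatedly (forcing steps), whenever a colored vertex has exactly one uncolored neighbor, that neighbor becomes colored, until no more changes occur. $S$ is a power dominating set of $G$ if all vertices end up colored. $p(G;i)$ denotes the number of power dominating sets of $G$ of cardinality $i$. -}

module Defs where

open import Data.Nat using (ℕ; zero; suc; _+_)
open import Data.Bool using (Bool; true; false; _∧_; _∨_; not; if_then_else_)
open import Data.Fin using (Fin)
open import Data.Fin.Subset using (Subset; ∣_∣; inside; outside)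
open import Data.Vec using (Vec; []; _∷_; tabulate; lookup)
open import Data.List using (List; []; _∷_; map; _++_; filter; length; allFin)
open import Data.Nat using (_≡ᵇ_)
open import Relation.Binary.PropositionalEquality using (_≡_)
open import Relation.Nullary.Decidable using (does)
open import Data.Bool.Properties using () renaming (_≟_ to _≟ᵇ_)

record Graph (n : ℕ) : Set where
  field
    adj   : Fin n → Fin n → Bool
    sym   : ∀ u v → adj u v ≡ adj v u
    irrefl : ∀ v → adj v v ≡ false
open Graph public

anyV : ∀ {n} → (Fin n → Bool) → Bool
anyV {n} f = Data.List.foldr _∨_ false (map f (allFin n))

countV : ∀ {n} → (Fin n → Bool) → ℕ
countV {n} f = length (filter (λ v → f v ≟ᵇ true) (allFin n))

dominate : ∀ {n} → Graph n → Subset n → Subset n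
dominate G S = tabulate λ v → lookup S v ∨ anyV (λ u → lookup S u ∧ adj G u v)

uncoloredNbrs : ∀ {n} → Graph n → Subset n → Fin n → ℕ
uncoloredNbrs G C u = countV (λ w → adj G u w ∧ not (lookup C w))

-- one (parallel) round of forcing: v becomes coloured if some coloured
-- neighbour u of v has v as its unique uncoloured neighbour
forceRound : ∀ {n} → Graph n → Subset n → Subset n
forceRound G C = tabulate λ v → lookup C v ∨
  anyV (λ u → lookup C u ∧ adj G u v ∧ not (lookup C v) ∧ (uncoloredNbrs G C u ≡ᵇ 1))

iterate : ∀ {A : Set} → ℕ → (A → A) → A → A
iterate zero f x = x
iterate (suc k) f x = f (iterate k f x)

-- Final colouring. Every round that changes the colouring colours at least one
-- new vertex, so after n rounds no more changes occur (the process has stabilised).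
finalColoring : ∀ {n} → Graph n → Subset n → Subset n
finalColoring {n} G S = iterate n (forceRound G) (dominate G S)

allColored : ∀ {n} → Subset n → Bool
allColored {n} C = Data.List.foldr _∧_ true (map (lookup C) (allFin n))

isPowerDominating : ∀ {n} → Graph n → Subset n → Bool
isPowerDominating G S = allColored (finalColoring G S)

allSubsets : (n : ℕ) → List (Subset n)
allSubsets zero = [] ∷ []
allSubsets (suc n) = map (inside ∷_) (allSubsets n) ++ map (outside ∷_) (allSubsets n)

p : ∀ {n} → Graph n → ℕ → ℕ
p {n} G i = length (filter (λ S → (isPowerDominating G S ∧ (∣ S ∣ ≡ᵇ i)) ≟ᵇ true) (allSubsets n))

module Submission where

-- (1) Power domination is upward closed: if S ⊆ T and S is power
--     dominating, so is T.  The domination step and a forcing round are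
--     both monotone maps on colourings; the only point needing care is
--     that if u forces v under X, and X ⊆ Y with v still uncoloured in Y,
--     then u still forces v under Y, because the uncoloured neighbours of u
--     w.r.t. Y form a subset of those w.r.t. X, and still contain v.
--     Iterating monotone maps is monotone, which gives (1).
--
-- (2) Counting: p(G;k) is the number of power dominating sets among the
--     C(n,k) subsets of size k, so p(G;k) = C(n,k) exactly when all
--     k-subsets are power dominating.
--
-- The theorem follows: a j-subset T (j ≥ i) contains an i-subset, which is
-- power dominating by (2), so T is by (1); hence p(G;j) = C(n,j) by (2).

open import Defs hiding (sym)
open import Data.Nat using (ℕ; suc; _≤_)
open import Data.Nat.Combinatorics using (_C_)
open import Relation.Binary.PropositionalEquality using (_≡_)

open import Data.Nat using (zero; _+_; s≤s; _≡ᵇ_)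
open import Data.Nat.Properties using (≤-antisym; ≡ᵇ⇒≡; ≡⇒≡ᵇ)
open import Data.Nat.Combinatorics using (nCk+nC[k+1]≡[n+1]C[k+1])
open import Data.Bool using (Bool; true; false; _∧_; _∨_; not; T)
open import Data.Bool.Properties using () renaming (_≟_ to _≟ᵇ_)
open import Data.Fin using (Fin)
open import Data.Fin.Subset using (Subset; ∣_∣; inside; outside; _⊆_; ⊥)
open import Data.Fin.Subset.Properties using (⊥⊆; ∣⊥∣≡0; out⊆; s⊆s)
open import Data.Vec using ([]; _∷_; tabulate; lookup)
open import Data.Vec.Properties using (lookup∘tabulate; []=⇒lookup; lookup⇒[]=)
open import Data.List using (List; []; _∷_; map; _++_; filter; length; allFin)
open import Data.Bool.ListAction using (any; all)
open import Data.List.Properties using (filter-++; length-++; filter-some; filter-all; filter-complete)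
open import Data.List.Relation.Unary.All as All using (All)
open import Data.List.Relation.Unary.All.Properties using (all-filter)
open import Data.List.Relation.Unary.Any using (here)
open import Data.List.Membership.Propositional using (_∈_; lose)
open import Data.List.Membership.Propositional.Properties using (∈-allFin; ∈-map⁺; ∈-++⁺ˡ; ∈-++⁺ʳ; ∈-filter⁺; ∈-filter⁻)
import Data.List.Relation.Binary.Sublist.Propositional as Sublist
import Data.List.Relation.Binary.Sublist.Propositional.Properties as Sublist
open import Data.Product using (Σ; _×_; _,_)
open import Relation.Nullary using (Dec)
open import Relation.Binary.PropositionalEquality using (refl; sym; trans; cong; cong₂; subst; module ≡-Reasoning)

isTrue? : {A : Set} (f : A → Bool) → (x : A) → Dec (f x ≡ true)
isTrue? f x = f x ≟ᵇ true

_⇒ᵇ_ : {A : Set} → (A → Bool) → (A → Bool) → Set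
f ⇒ᵇ g = ∀ x → f x ≡ true → g x ≡ true

T⇒≡true : ∀ {b} → T b → b ≡ true
T⇒≡true {true} _ = refl

≡true⇒T : ∀ {b} → b ≡ true → T b
≡true⇒T refl = _

∧-true : ∀ {a b} → a ∧ b ≡ true → a ≡ true × b ≡ true
∧-true {true} b≡true = refl , b≡true

∧-intro : ∀ {a b} → a ≡ true → b ≡ true → a ∧ b ≡ true
∧-intro refl refl = refl

-- Monotonicity of ∨; the second premise may assume that c is false, since
-- otherwise the conclusion holds outright.
∨-mono : ∀ {a b c d} → (a ≡ true → c ≡ true) → (c ≡ false → b ≡ true → d ≡ true) →
         a ∨ b ≡ true → c ∨ d ≡ true
∨-mono {c = true} _ _ _ = refl
∨-mono {true} {c = false} a⇒c _ _ with () ← a⇒c refl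
∨-mono {false} {c = false} _ b⇒d b = b⇒d refl b

not-antitone : ∀ {a b} → (a ≡ true → b ≡ true) → not b ≡ true → not a ≡ true
not-antitone {false} _ _ = refl
not-antitone {true} a⇒b nb with () ← trans (sym (cong not (a⇒b refl))) nb

any-mono : {A : Set} {f g : A → Bool} → f ⇒ᵇ g → ∀ xs → any f xs ≡ true → any g xs ≡ true
any-mono f⇒g []       ()
any-mono f⇒g (x ∷ xs) = ∨-mono (f⇒g x) (λ _ → any-mono f⇒g xs)

all-mono : {A : Set} {f g : A → Bool} → f ⇒ᵇ g → ∀ xs → all f xs ≡ true → all g xs ≡ true
all-mono f⇒g []       _ = refl
all-mono f⇒g (x ∷ xs) h with ∧-true h
... | fx , rest = ∧-intro (f⇒g x fx) (all-mono f⇒g xs rest)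

countV-mono : ∀ {n} {f g : Fin n → Bool} → f ⇒ᵇ g → countV f ≤ countV g
countV-mono {n} {f} {g} f⇒g = Sublist.length-mono-≤
  (Sublist.filter⁺ (isTrue? f) (isTrue? g) (λ { refl → f⇒g _ }) (Sublist.⊆-refl {x = allFin n}))

countV-pos : ∀ {n} {f : Fin n → Bool} v → f v ≡ true → 1 ≤ countV f
countV-pos {f = f} v fv = filter-some (isTrue? f) (lose (∈-allFin v) fv)

⊆-elim : ∀ {n} {X Y : Subset n} → X ⊆ Y → ∀ v → lookup X v ≡ true → lookup Y v ≡ true
⊆-elim X⊆Y v Xv = []=⇒lookup (X⊆Y (lookup⇒[]= v _ Xv))

⊆-tabulate : ∀ {n} {f g : Fin n → Bool} → f ⇒ᵇ g → tabulate f ⊆ tabulate g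
⊆-tabulate {f = f} {g} f⇒g {v} v∈f = lookup⇒[]= v _ (begin
    lookup (tabulate g) v ≡⟨ lookup∘tabulate g v ⟩
    g v                   ≡⟨ f⇒g v (trans (sym (lookup∘tabulate f v)) ([]=⇒lookup v∈f)) ⟩
    true                  ∎)
  where open ≡-Reasoning

subset-of-size : ∀ {m} (T : Subset m) k → k ≤ ∣ T ∣ → Σ (Subset m) λ S → S ⊆ T × ∣ S ∣ ≡ k
subset-of-size {m} T       zero    _ = ⊥ , ⊥⊆ , ∣⊥∣≡0 m
subset-of-size (inside ∷ T)  (suc k) (s≤s k≤∣T∣) with subset-of-size T k k≤∣T∣
... | S , S⊆T , ∣S∣≡k = inside ∷ S , s⊆s S⊆T , cong suc ∣S∣≡k
subset-of-size (outside ∷ T) (suc k) k≤∣T∣ with subset-of-size T (suc k) k≤∣T∣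
... | S , S⊆T , ∣S∣≡k = outside ∷ S , out⊆ S⊆T , ∣S∣≡k

Monotone : ∀ {n} → (Subset n → Subset n) → Set
Monotone F = ∀ {X Y} → X ⊆ Y → F X ⊆ F Y

iterate-mono : ∀ {n} {F : Subset n → Subset n} → Monotone F → ∀ k → Monotone (iterate k F)
iterate-mono F-mono zero    X⊆Y = X⊆Y
iterate-mono F-mono (suc k) X⊆Y = F-mono (iterate-mono F-mono k X⊆Y)

dominate-mono : ∀ {n} (G : Graph n) → Monotone (dominate G)
dominate-mono {n} G {X} {Y} X⊆Y = ⊆-tabulate λ v →
  ∨-mono (⊆-elim X⊆Y v) (λ _ → any-mono (neighbour-mono v) (allFin n))
  where
  neighbour-mono : ∀ v → (λ u → lookup X u ∧ adj G u v) ⇒ᵇ (λ u → lookup Y u ∧ adj G u v)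
  neighbour-mono v u h with ∧-true h
  ... | Xu , uv = ∧-intro (⊆-elim X⊆Y u Xu) uv

uncoloredNbrs-antitone : ∀ {n} (G : Graph n) {X Y} → X ⊆ Y → ∀ u →
                         uncoloredNbrs G Y u ≤ uncoloredNbrs G X u
uncoloredNbrs-antitone G {X} {Y} X⊆Y u = countV-mono fewer
  where
  fewer : (λ w → adj G u w ∧ not (lookup Y w)) ⇒ᵇ (λ w → adj G u w ∧ not (lookup X w))
  fewer w h with ∧-true h
  ... | uw , Yw = ∧-intro uw (not-antitone (⊆-elim X⊆Y w) Yw)

forces : ∀ {n} → Graph n → Subset n → Fin n → Fin n → Bool
forces G X u v = lookup X u ∧ adj G u v ∧ not (lookup X v) ∧ (uncoloredNbrs G X u ≡ᵇ 1)

forces-mono : ∀ {n} (G : Graph n) {X Y u v} → X ⊆ Y → lookup Y v ≡ false →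
              forces G X u v ≡ true → forces G Y u v ≡ true
forces-mono G {X} {Y} {u} {v} X⊆Y Yv h with ∧-true h
... | Xu , rest with ∧-true rest
... | uv , rest′ with ∧-true rest′
... | _ , unique = ∧-intro (⊆-elim X⊆Y u Xu) (∧-intro uv (∧-intro (cong not Yv) uniqueD))
  where
  atMostOne : uncoloredNbrs G Y u ≤ 1
  atMostOne = subst (uncoloredNbrs G Y u ≤_) (≡ᵇ⇒≡ _ 1 (≡true⇒T unique))
                    (uncoloredNbrs-antitone G X⊆Y u)
  atLeastOne : 1 ≤ uncoloredNbrs G Y u
  atLeastOne = countV-pos v (∧-intro uv (cong not Yv))
  uniqueD : (uncoloredNbrs G Y u ≡ᵇ 1) ≡ true
  uniqueD rewrite ≤-antisym atMostOne atLeastOne = refl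

forceRound-mono : ∀ {n} (G : Graph n) → Monotone (forceRound G)
forceRound-mono {n} G {X} {Y} X⊆Y = ⊆-tabulate {f = step X} {g = step Y} step-mono
  where
  step : Subset n → Fin n → Bool
  step E v = lookup E v ∨ anyV (λ u → forces G E u v)
  step-mono : step X ⇒ᵇ step Y
  step-mono v = ∨-mono (⊆-elim X⊆Y v) λ Yv → any-mono (λ u → forces-mono G X⊆Y Yv) (allFin n)

powerDominating-upward : ∀ {n} (G : Graph n) {S T} → S ⊆ T →
                         isPowerDominating G S ≡ true → isPowerDominating G T ≡ true
powerDominating-upward {n} G {S} {T} S⊆T = all-mono (⊆-elim final⊆) (allFin n)
  where
  final⊆ : finalColoring G S ⊆ finalColoring G T
  final⊆ = iterate-mono (forceRound-mono G) n (dominate-mono G S⊆T)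

sized : ∀ n → ℕ → List (Subset n)
sized n k = filter (isTrue? λ S → ∣ S ∣ ≡ᵇ k) (allSubsets n)

filter-map-length : {A B : Set} {P : B → Set} (P? : ∀ y → Dec (P y)) (h : A → B) (xs : List A) →
                    length (filter P? (map h xs)) ≡ length (filter (λ x → P? (h x)) xs)
filter-map-length P? h []       = refl
filter-map-length P? h (x ∷ xs) with Dec.does (P? (h x))
... | true  = cong suc (filter-map-length P? h xs)
... | false = filter-map-length P? h xs

filter-false : {A : Set} (xs : List A) → filter (isTrue? λ _ → false) xs ≡ []
filter-false []       = refl
filter-false (x ∷ xs) = filter-false xs

-- There are C(n,k) subsets of size k: split on whether vertex 0 is in S.
length-sized : ∀ n k → length (sized n k) ≡ n C k
length-sized zero    zero    = refl
length-sized zero    (suc k) = refl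
length-sized (suc n) k = begin
    length (sized (suc n) k)
  ≡⟨ cong length (filter-++ size? (map (inside ∷_) (allSubsets n)) (map (outside ∷_) (allSubsets n))) ⟩
    length (filter size? (map (inside ∷_) (allSubsets n)) ++ filter size? (map (outside ∷_) (allSubsets n)))
  ≡⟨ length-++ (filter size? (map (inside ∷_) (allSubsets n))) ⟩
    length (filter size? (map (inside ∷_) (allSubsets n))) + length (filter size? (map (outside ∷_) (allSubsets n)))
  ≡⟨ cong₂ _+_ (filter-map-length size? (inside ∷_) (allSubsets n)) (filter-map-length size? (outside ∷_) (allSubsets n)) ⟩
    length (filter (isTrue? λ S → suc ∣ S ∣ ≡ᵇ k) (allSubsets n)) + length (sized n k)
  ≡⟨ pascal k ⟩
    suc n C k
  ∎
  where
  open ≡-Reasoning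
  size? : (S : Subset (suc n)) → Dec ((∣ S ∣ ≡ᵇ k) ≡ true)
  size? = isTrue? λ S → ∣ S ∣ ≡ᵇ k
  pascal : ∀ k → length (filter (isTrue? λ S → suc ∣ S ∣ ≡ᵇ k) (allSubsets n)) + length (sized n k) ≡ suc n C k
  pascal zero    rewrite filter-false (allSubsets n) = length-sized n zero
  pascal (suc k) rewrite length-sized n k | length-sized n (suc k) = nCk+nC[k+1]≡[n+1]C[k+1] n k

allSubsets-complete : ∀ {n} (S : Subset n) → S ∈ allSubsets n
allSubsets-complete []            = here refl
allSubsets-complete {suc n} (inside ∷ S)  = ∈-++⁺ˡ (∈-map⁺ (inside ∷_) (allSubsets-complete S))
allSubsets-complete {suc n} (outside ∷ S) =
  ∈-++⁺ʳ (map (inside ∷_) (allSubsets n)) (∈-map⁺ (outside ∷_) (allSubsets-complete S))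

filter-∧ : {A : Set} (f g : A → Bool) (xs : List A) →
           filter (isTrue? λ x → f x ∧ g x) xs ≡ filter (isTrue? f) (filter (isTrue? g) xs)
filter-∧ f g []       = refl
filter-∧ f g (x ∷ xs) with f x in fx | g x
... | true  | true  rewrite fx = cong (x ∷_) (filter-∧ f g xs)
... | true  | false = filter-∧ f g xs
... | false | true  rewrite fx = filter-∧ f g xs
... | false | false = filter-∧ f g xs

filter-full⇒all : {A : Set} {P : A → Set} (P? : ∀ x → Dec (P x)) (xs : List A) →
                  length (filter P? xs) ≡ length xs → ∀ {x} → x ∈ xs → P x
filter-full⇒all P? xs full = All.lookup (subst (All _) (filter-complete P? full) (all-filter P? xs))

all⇒filter-full : {A : Set} {P : A → Set} (P? : ∀ x → Dec (P x)) (xs : List A) →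
                  (∀ {x} → x ∈ xs → P x) → length (filter P? xs) ≡ length xs
all⇒filter-full P? xs all-P = cong length (filter-all P? (All.tabulate all-P))

module _ {n : ℕ} (G : Graph n) (k : ℕ) where

  private
    pd? : (S : Subset n) → Dec (isPowerDominating G S ≡ true)
    pd? = isTrue? (isPowerDominating G)

  p-as-filter : p G k ≡ length (filter pd? (sized n k))
  p-as-filter = cong length (filter-∧ (isPowerDominating G) (λ S → ∣ S ∣ ≡ᵇ k) (allSubsets n))

  ∈-sized : ∀ {S} → ∣ S ∣ ≡ k → S ∈ sized n k
  ∈-sized {S} refl = ∈-filter⁺ (isTrue? λ S → ∣ S ∣ ≡ᵇ k) {xs = allSubsets n}
                               (allSubsets-complete S) (T⇒≡true (≡⇒≡ᵇ ∣ S ∣ ∣ S ∣ refl))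

  sized-size : ∀ {S} → S ∈ sized n k → ∣ S ∣ ≡ k
  sized-size S∈ with ∈-filter⁻ (isTrue? λ S → ∣ S ∣ ≡ᵇ k) {xs = allSubsets n} S∈
  ... | _ , size≡ᵇk = ≡ᵇ⇒≡ _ k (≡true⇒T size≡ᵇk)

  p≡C⇒all-sized : p G k ≡ n C k → ∀ S → ∣ S ∣ ≡ k → isPowerDominating G S ≡ true
  p≡C⇒all-sized p≡C S ∣S∣≡k = filter-full⇒all pd? (sized n k) full {S} (∈-sized ∣S∣≡k)
    where
    full : length (filter pd? (sized n k)) ≡ length (sized n k)
    full = trans (sym p-as-filter) (trans p≡C (sym (length-sized n k)))

  all-sized⇒p≡C : (∀ S → ∣ S ∣ ≡ k → isPowerDominating G S ≡ true) → p G k ≡ n C k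
  all-sized⇒p≡C all-pd = begin
      p G k                              ≡⟨ p-as-filter ⟩
      length (filter pd? (sized n k))    ≡⟨ all⇒filter-full pd? (sized n k) (λ {S} S∈ → all-pd S (sized-size S∈)) ⟩
      length (sized n k)                 ≡⟨ length-sized n k ⟩
      n C k                              ∎
    where open ≡-Reasoning

proposition3 : (n : ℕ) (G : Graph (suc n)) (i : ℕ) → 1 ≤ i → i ≤ suc n →
    p G i ≡ suc n C i → (j : ℕ) → i ≤ j → j ≤ suc n → p G j ≡ suc n C j
proposition3 n G i _ _ p≡C j i≤j _ = all-sized⇒p≡C G j j-sets-pd
  where
  i-sets-pd : ∀ S → ∣ S ∣ ≡ i → isPowerDominating G S ≡ true
  i-sets-pd = p≡C⇒all-sized G i p≡C
  j-sets-pd : ∀ T → ∣ T ∣ ≡ j → isPowerDominating G T ≡ true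
  j-sets-pd T refl with subset-of-size T i i≤j
  ... | S , S⊆T , ∣S∣≡i = powerDominating-upward G S⊆T (i-sets-pd S ∣S∣≡i)
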